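{- Let $G$ be a graph of order $n$ with vertex-degree sequence $S_G=(g_0,g_1,\dots,g_{n-1})$, and let $D_n$ be a maximal Diophantine graph of order $n$ with vertex-degree sequence $S_{D_n}=(d_0,d_1,\dots,d_{n-1})$. If $G$ is Diophantine, then for every $k\in\{0,1,\dots,n-1\}$, $$\sum_{i=0}^{k}g_i\ \ge\ \sum_{i=0}^{k}d_i.$$
   Context: All graphs are finite, simple and undirected. A graph $G$ with $n$ vertices is Diophantine if there is a bijection $f:V(G)\to\{1,\dots,n\}$ such that $\gcd(f(u),f(v))\mid n$ for every edge $uv$. A maximal Diophantine graph $D_n$ of order $n$ is a Diophantine graph of order $n$ such that adding any new edge yields a non-Diophantine graph. The vertex-degree sequence of a graph $H$ of order $n$ is $S_H=(h_0,\dots,h_{n-1})$ where $h_i$ is the number of vertices of $H$ of degree $i$. -}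

module Defs where

open import Data.Nat using (ℕ; zero; suc; _+_)
open import Data.Nat.Divisibility using (_∣_)
open import Data.Nat.GCD using (gcd)
open import Data.Fin using (Fin; toℕ)
open import Data.Fin.Properties using (_≟_)
open import Data.Bool using (Bool; true; false; _∨_; _∧_; not)
open import Data.List using (List; filterᵇ; length; allFin; upTo; map)
open import Data.Nat.ListAction using (sum)
open import Data.Product using (Σ; _×_; _,_)
open import Data.Sum using (_⊎_)
open import Function.Bundles using (_⇔_)
open import Relation.Nullary using (¬_)
open import Relation.Nullary.Decidable using (⌊_⌋)
open import Relation.Binary.PropositionalEquality using (_≡_)
open import Function.Definitions using (Bijective)

record Graph (n : ℕ) : Set where
  field
    adj   : Fin n → Fin n → Bool
    sym   : ∀ u v → adj u v ≡ adj v u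
    irrefl : ∀ u → adj u u ≡ false
open Graph public

degree : ∀ {n} → Graph n → Fin n → ℕ
degree G u = length (filterᵇ (adj G u) (allFin _))

degSeq : ∀ {n} → Graph n → ℕ → ℕ
degSeq G i = length (filterᵇ (λ v → ⌊ degree G v Data.Nat.≟ i ⌋) (allFin _))

partialDegSum : ∀ {n} → Graph n → ℕ → ℕ
partialDegSum G k = sum (map (degSeq G) (upTo (suc k)))

-- Diophantine labeling: bijection f onto labels {1..n} (label of v is toℕ (f v) + 1)
-- with gcd(f u, f v) ∣ n for every edge uv.
IsDiophantineLabeling : ∀ {n} → Graph n → (Fin n → Fin n) → Set
IsDiophantineLabeling {n} G f =
  Bijective _≡_ _≡_ f ×
  (∀ u v → adj G u v ≡ true → gcd (suc (toℕ (f u))) (suc (toℕ (f v))) ∣ n)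

Diophantine : ∀ {n} → Graph n → Set
Diophantine {n} G = Σ (Fin n → Fin n) (IsDiophantineLabeling G)

IsAddEdge : ∀ {n} → Graph n → Fin n → Fin n → Graph n → Set
IsAddEdge G u v H = ∀ x y →
  (adj H x y ≡ true) ⇔ (adj G x y ≡ true ⊎ ((x ≡ u × y ≡ v) ⊎ (x ≡ v × y ≡ u)))

MaximalDiophantine : ∀ {n} → Graph n → Set
MaximalDiophantine {n} D =
  Diophantine D ×
  (∀ (u v : Fin n) → ¬ u ≡ v → adj D u v ≡ false →
     ∀ (H : Graph n) → IsAddEdge D u v H → ¬ Diophantine H)

-- Let L be the graph on the labels 1, …, n joining two distinct labels whose gcd divides n.
-- A Diophantine labeling of G maps edges to edges of L, so each vertex of G has degree at
-- most the L-degree of its label. If D is maximal, a Diophantine labeling of D misses no edge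
-- of L (adding the missing edge would keep the labeling Diophantine), so it is an isomorphism
-- D ≅ L. Hence #{v : deg_D v ≤ k} = #{a : deg_L a ≤ k} ≤ #{v : deg_G v ≤ k}, and these counts
-- are the partial sums of the degree sequences.
module Submission where

open import Defs hiding (sym)
open import Data.Nat as ℕ using (ℕ; zero; suc; _+_; _<_; _≥_; _≤_; _≡ᵇ_; _<ᵇ_)
open import Data.Nat.Properties using (+-0-commutativeMonoid; +-identityʳ; ≤-<-trans; <ᵇ⇒<; <⇒<ᵇ; module ≤-Reasoning)
open import Data.Nat.Divisibility using (_∣_; _∣?_)
open import Data.Nat.GCD using (gcd; gcd-comm)
open import Data.Nat.ListAction using (sum)
open import Data.Nat.ListAction.Properties using (sum-++)
open import Data.Fin using (Fin; toℕ)
open import Data.Fin.Properties using (_≟_)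
open import Data.Bool using (Bool; true; false; T; _∨_)
open import Data.Bool.Properties using (T-≡; ¬-not; ∨-zeroʳ; ∨-identityʳ)
open import Data.List using (_∷_; []; _++_; filterᵇ; length; allFin; tabulate; upTo; map)
open import Data.List.Properties using (upTo-∷ʳ; map-++)
open import Data.List.Relation.Binary.Sublist.Heterogeneous.Properties using (length-mono-≤; ⊆-filter-Sublist)
open import Data.List.Relation.Binary.Sublist.Propositional using (⊆-refl)
open import Data.Product using (_×_; _,_; proj₁; proj₂; swap)
open import Data.Sum using (_⊎_; inj₁; inj₂; [_,_])
open import Data.Empty using (⊥-elim)
open import Function using (_∘_; id)
open import Function.Bundles using (_⇔_; Equivalence; mk⇔; mk⤖)
open import Function.Definitions using (Bijective)
open import Function.Properties.Bijection using (⤖⇒↔)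
open import Relation.Nullary using (¬_; Dec; yes; no; does; ¬?; _×-dec_; _⊎-dec_)
open import Relation.Nullary.Decidable using (⌊_⌋; isYes≗does; T?; toWitness; fromWitness; dec-false; does-⇔)
open import Relation.Binary.PropositionalEquality using (_≡_; _≢_; _≗_; refl; sym; trans; cong; cong₂; subst; module ≡-Reasoning)
open import Algebra.Properties.CommutativeMonoid.Sum +-0-commutativeMonoid using (sum-syntax; sum-cong-≗; sum-replicate-zero; sum-permute; ∑-distrib-+)

open Equivalence

indicator : Bool → ℕ
indicator true  = 1
indicator false = 0

count : ∀ {n} → (Fin n → Bool) → ℕ
count p = length (filterᵇ p (allFin _))

length-filterᵇ-tabulate : ∀ {A : Set} n (p : A → Bool) (h : Fin n → A) →
  length (filterᵇ p (tabulate h)) ≡ ∑[ i < n ] indicator (p (h i))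
length-filterᵇ-tabulate zero    p h = refl
length-filterᵇ-tabulate (suc n) p h with p (h Fin.zero)
... | true  = cong suc (length-filterᵇ-tabulate n p (h ∘ Fin.suc))
... | false = length-filterᵇ-tabulate n p (h ∘ Fin.suc)

count≡∑ : ∀ {n} (p : Fin n → Bool) → count p ≡ ∑[ i < n ] indicator (p i)
count≡∑ {n} p = length-filterᵇ-tabulate n p id

count-cong : ∀ {n} {p q : Fin n → Bool} → p ≗ q → count p ≡ count q
count-cong {p = p} {q} p≗q =
  trans (count≡∑ p) (trans (sum-cong-≗ (cong indicator ∘ p≗q)) (sym (count≡∑ q)))

count-mono : ∀ {n} {p q : Fin n → Bool} → (∀ i → T (p i) → T (q i)) → count p ≤ count q
count-mono {n} {p} {q} p⇒q =
  length-mono-≤ (⊆-filter-Sublist (T? ∘ p) (T? ∘ q) (λ { refl → p⇒q _ }) (⊆-refl {x = allFin n}))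

count-∘-bijective : ∀ {n} {f : Fin n → Fin n} → Bijective _≡_ _≡_ f →
  (p : Fin n → Bool) → count (p ∘ f) ≡ count p
count-∘-bijective {n} {f} f-bij p = begin
  count (p ∘ f)                   ≡⟨ count≡∑ (p ∘ f) ⟩
  ∑[ i < n ] indicator (p (f i))  ≡⟨ sum-permute (indicator ∘ p) (⤖⇒↔ (mk⤖ f-bij)) ⟨
  ∑[ i < n ] indicator (p i)      ≡⟨ count≡∑ p ⟨
  count p                         ∎
  where open ≡-Reasoning

count-+ : ∀ {n} {p q r : Fin n → Bool} →
  (∀ i → indicator (p i) + indicator (q i) ≡ indicator (r i)) → count p + count q ≡ count r
count-+ {n} {p} {q} {r} pq≡r = begin
  count p + count q                                       ≡⟨ cong₂ _+_ (count≡∑ p) (count≡∑ q) ⟩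
  ∑[ i < n ] indicator (p i) + ∑[ i < n ] indicator (q i) ≡⟨ ∑-distrib-+ (indicator ∘ p) (indicator ∘ q) ⟨
  ∑[ i < n ] (indicator (p i) + indicator (q i))          ≡⟨ sum-cong-≗ pq≡r ⟩
  ∑[ i < n ] indicator (r i)                              ≡⟨ count≡∑ r ⟨
  count r                                                 ∎
  where open ≡-Reasoning

countBelow : ∀ {n} → (Fin n → ℕ) → ℕ → ℕ
countBelow d k = count (λ v → d v <ᵇ k)

countBelow-cong : ∀ {n} {d e : Fin n → ℕ} → d ≗ e → ∀ k → countBelow d k ≡ countBelow e k
countBelow-cong d≗e k = count-cong (cong (_<ᵇ k) ∘ d≗e)

countBelow-antimono : ∀ {n} {d e : Fin n → ℕ} → (∀ v → d v ≤ e v) → ∀ k → countBelow e k ≤ countBelow d k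
countBelow-antimono {e = e} d≤e k = count-mono (λ v → <⇒<ᵇ ∘ ≤-<-trans (d≤e v) ∘ <ᵇ⇒< (e v) k)

countBelow-∘-bijective : ∀ {n} {f : Fin n → Fin n} → Bijective _≡_ _≡_ f →
  ∀ (d : Fin n → ℕ) k → countBelow (d ∘ f) k ≡ countBelow d k
countBelow-∘-bijective f-bij d k = count-∘-bijective f-bij ((_<ᵇ k) ∘ d)

indicator-<ᵇ-suc : ∀ x k → indicator (x <ᵇ k) + indicator (x ≡ᵇ k) ≡ indicator (x <ᵇ suc k)
indicator-<ᵇ-suc zero    zero    = refl
indicator-<ᵇ-suc zero    (suc k) = refl
indicator-<ᵇ-suc (suc x) zero    = refl
indicator-<ᵇ-suc (suc x) (suc k) = indicator-<ᵇ-suc x k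

sum-count-≟-upTo : ∀ {n} (d : Fin n → ℕ) k →
  sum (map (λ i → count (λ v → ⌊ d v ℕ.≟ i ⌋)) (upTo k)) ≡ countBelow d k
sum-count-≟-upTo {n} d zero    = sym (trans (count≡∑ (λ v → d v <ᵇ 0)) (sum-replicate-zero n))
sum-count-≟-upTo d (suc k) = begin
  sum (map fibre (upTo (suc k)))            ≡⟨ cong (sum ∘ map fibre) (upTo-∷ʳ k) ⟨
  sum (map fibre (upTo k ++ k ∷ []))        ≡⟨ cong sum (map-++ fibre (upTo k) (k ∷ [])) ⟩
  sum (map fibre (upTo k) ++ fibre k ∷ [])  ≡⟨ sum-++ (map fibre (upTo k)) (fibre k ∷ []) ⟩
  sum (map fibre (upTo k)) + (fibre k + 0)  ≡⟨ cong₂ _+_ (sum-count-≟-upTo d k) (+-identityʳ (fibre k)) ⟩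
  countBelow d k + fibre k                  ≡⟨ count-+ fibre-step ⟩
  countBelow d (suc k)                      ∎
  where
  open ≡-Reasoning
  fibre : ℕ → ℕ
  fibre i = count (λ v → ⌊ d v ℕ.≟ i ⌋)
  -- ⌊ x ≟ k ⌋ is stuck for open x, whereas its does-form computes to x ≡ᵇ k.
  fibre-step : ∀ v → indicator (d v <ᵇ k) + indicator ⌊ d v ℕ.≟ k ⌋ ≡ indicator (d v <ᵇ suc k)
  fibre-step v rewrite isYes≗does (d v ℕ.≟ k) = indicator-<ᵇ-suc (d v) k

∨-does≡true⇔ : ∀ {A : Set} b (a? : Dec A) → (b ∨ does a? ≡ true) ⇔ (b ≡ true ⊎ A)
∨-does≡true⇔ b (yes a) = mk⇔ (λ _ → inj₂ a) (λ _ → ∨-zeroʳ b)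
∨-does≡true⇔ b (no ¬a) =
  mk⇔ (inj₁ ∘ trans (sym (∨-identityʳ b))) [ trans (∨-identityʳ b) , ⊥-elim ∘ ¬a ]

LabelsCompatible : (n : ℕ) → Fin n → Fin n → Set
LabelsCompatible n a b = gcd (suc (toℕ a)) (suc (toℕ b)) ∣ n

LabelsCompatible-sym : ∀ {n} a b → LabelsCompatible n a b → LabelsCompatible n b a
LabelsCompatible-sym {n} a b = subst (_∣ n) (gcd-comm (suc (toℕ a)) (suc (toℕ b)))

labelAdj : (n : ℕ) → Fin n → Fin n → Bool
labelAdj n a b = ⌊ ¬? (a ≟ b) ×-dec gcd (suc (toℕ a)) (suc (toℕ b)) ∣? n ⌋

labelDegree : (n : ℕ) → Fin n → ℕ
labelDegree n a = count (labelAdj n a)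

module _ {n : ℕ} where

  labeling-preserves-adj : ∀ (G : Graph n) f → IsDiophantineLabeling G f →
    ∀ u v → adj G u v ≡ true → T (labelAdj n (f u) (f v))
  labeling-preserves-adj G f (f-bij , f-div) u v uv∈G = fromWitness (fu≢fv , f-div u v uv∈G)
    where
    fu≢fv : f u ≢ f v
    fu≢fv fu≡fv with refl ← f-bij .proj₁ fu≡fv with () ← trans (sym uv∈G) (irrefl G u)

  degree≤labelDegree : ∀ (G : Graph n) f → IsDiophantineLabeling G f →
    ∀ u → degree G u ≤ labelDegree n (f u)
  degree≤labelDegree G f f-lab u = begin
    count (adj G u)               ≤⟨ count-mono (λ v → labeling-preserves-adj G f f-lab u v ∘ to T-≡) ⟩
    count (labelAdj n (f u) ∘ f)  ≡⟨ count-∘-bijective (f-lab .proj₁) (labelAdj n (f u)) ⟩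
    count (labelAdj n (f u))      ∎
    where open ≤-Reasoning

  IsEdgeBetween : Fin n → Fin n → Fin n → Fin n → Set
  IsEdgeBetween u v x y = (x ≡ u × y ≡ v) ⊎ (x ≡ v × y ≡ u)

  isEdgeBetween? : ∀ u v x y → Dec (IsEdgeBetween u v x y)
  isEdgeBetween? u v x y = (x ≟ u ×-dec y ≟ v) ⊎-dec (x ≟ v ×-dec y ≟ u)

  IsEdgeBetween-sym : ∀ {u v x y} → IsEdgeBetween u v x y → IsEdgeBetween u v y x
  IsEdgeBetween-sym = [ inj₂ ∘ swap , inj₁ ∘ swap ]

  IsEdgeBetween-irrefl : ∀ {u v} → u ≢ v → ∀ x → ¬ IsEdgeBetween u v x x
  IsEdgeBetween-irrefl u≢v x (inj₁ (x≡u , x≡v)) = u≢v (trans (sym x≡u) x≡v)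
  IsEdgeBetween-irrefl u≢v x (inj₂ (x≡v , x≡u)) = u≢v (trans (sym x≡u) x≡v)

  addEdge : Graph n → ∀ {u v} → u ≢ v → Graph n
  addEdge G {u} {v} u≢v = record
    { adj    = λ x y → adj G x y ∨ does (isEdgeBetween? u v x y)
    ; sym    = λ x y → cong₂ _∨_ (Graph.sym G x y)
                 (does-⇔ (mk⇔ IsEdgeBetween-sym IsEdgeBetween-sym)
                   (isEdgeBetween? u v x y) (isEdgeBetween? u v y x))
    ; irrefl = λ x → cong₂ _∨_ (irrefl G x)
                 (dec-false (isEdgeBetween? u v x x) (IsEdgeBetween-irrefl u≢v x))
    }

  addEdge-isAddEdge : ∀ (G : Graph n) {u v} (u≢v : u ≢ v) → IsAddEdge G u v (addEdge G u≢v)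
  addEdge-isAddEdge G {u} {v} u≢v x y = ∨-does≡true⇔ (adj G x y) (isEdgeBetween? u v x y)

  isAddEdge-preserves-labeling : ∀ (G H : Graph n) {u v} f → IsAddEdge G u v H →
    IsDiophantineLabeling G f → LabelsCompatible n (f u) (f v) → IsDiophantineLabeling H f
  isAddEdge-preserves-labeling G H {u} {v} f H≡G+uv (f-bij , f-div) fu~fv = f-bij , H-div
    where
    H-div : ∀ x y → adj H x y ≡ true → LabelsCompatible n (f x) (f y)
    H-div x y xy∈H with H≡G+uv x y .to xy∈H
    ... | inj₁ xy∈G                 = f-div x y xy∈G
    ... | inj₂ (inj₁ (refl , refl)) = fu~fv
    ... | inj₂ (inj₂ (refl , refl)) = LabelsCompatible-sym (f u) (f v) fu~fv

  module _ (D : Graph n) (D-max : MaximalDiophantine D) (f : Fin n → Fin n)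
           (f-lab : IsDiophantineLabeling D f) where

    maximal-adj≡labelAdj : ∀ u v → adj D u v ≡ labelAdj n (f u) (f v)
    maximal-adj≡labelAdj u v with adj D u v in uv∈D
    ... | true  = sym (to T-≡ (labeling-preserves-adj D f f-lab u v uv∈D))
    ... | false = sym (¬-not fu≁fv)
      where
      fu≁fv : labelAdj n (f u) (f v) ≢ true
      fu≁fv fu-fv∈L with fu≢fv , fu~fv ← toWitness (from T-≡ fu-fv∈L) =
        D-max .proj₂ u v u≢v uv∈D (addEdge D u≢v) D+uv
          (f , isAddEdge-preserves-labeling D (addEdge D u≢v) f D+uv f-lab fu~fv)
        where
        u≢v : u ≢ v
        u≢v = fu≢fv ∘ cong f
        D+uv : IsAddEdge D u v (addEdge D u≢v)
        D+uv = addEdge-isAddEdge D u≢v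

    maximal-degree≡labelDegree : ∀ u → degree D u ≡ labelDegree n (f u)
    maximal-degree≡labelDegree u =
      trans (count-cong (maximal-adj≡labelAdj u)) (count-∘-bijective (f-lab .proj₁) (labelAdj n (f u)))

  diophantine-countBelow : ∀ (G : Graph n) → Diophantine G →
    ∀ k → countBelow (labelDegree n) k ≤ countBelow (degree G) k
  diophantine-countBelow G (g , g-lab) k = begin
    countBelow (labelDegree n) k      ≡⟨ countBelow-∘-bijective (g-lab .proj₁) (labelDegree n) k ⟨
    countBelow (labelDegree n ∘ g) k  ≤⟨ countBelow-antimono (degree≤labelDegree G g g-lab) k ⟩
    countBelow (degree G) k           ∎
    where open ≤-Reasoning

  maximal-countBelow : ∀ (D : Graph n) → MaximalDiophantine D →
    ∀ k → countBelow (degree D) k ≡ countBelow (labelDegree n) k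
  maximal-countBelow D D-max@((f , f-lab) , _) k = begin
    countBelow (degree D) k           ≡⟨ countBelow-cong (maximal-degree≡labelDegree D D-max f f-lab) k ⟩
    countBelow (labelDegree n ∘ f) k  ≡⟨ countBelow-∘-bijective (f-lab .proj₁) (labelDegree n) k ⟩
    countBelow (labelDegree n) k      ∎
    where open ≡-Reasoning

theorem3p19 : ∀ (n : ℕ) (G D : Graph n) → MaximalDiophantine D → Diophantine G →
    ∀ (k : ℕ) → k < n → partialDegSum G k ≥ partialDegSum D k
theorem3p19 n G D D-max G-dioph k _ = begin
  partialDegSum D k                   ≡⟨ sum-count-≟-upTo (degree D) (suc k) ⟩
  countBelow (degree D) (suc k)       ≡⟨ maximal-countBelow D D-max (suc k) ⟩
  countBelow (labelDegree n) (suc k)  ≤⟨ diophantine-countBelow G G-dioph (suc k) ⟩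
  countBelow (degree G) (suc k)       ≡⟨ sum-count-≟-upTo (degree G) (suc k) ⟨
  partialDegSum G k                   ∎
  where open ≤-Reasoning
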